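{- Let $t$ be a positive integer, $v=4(t+1)$, $m=\lfloor \frac{t+1}{6}\rfloor$ and $m'=v-24m$ (so $m'\in\{0,4,8,12,16,20\}$). Then there exists a balanced trade with block-size $k=2(t+1)$, given by a balanced companion collection on $[v]$, whose total set discrepancy under popularity changes of magnitude $p=1$ equals $12m+\Delta$, where $\Delta=-2,2,4,6,6,8$ for $m'=0,4,8,12,16,20$, respectively.
   Context: A balanced companion collection on $[v]$, $v=4(t+1)$, is a partition of $[v]$ into $2(t+1)$ sets $S_1,\ldots,S_{2t+2}$, each of cardinality $2$, grouped into $t+1$ companion pairs $(S_{2i-1},S_{2i})$, such that $\sum_{\ell\in S_{2i-1}}\ell=\sum_{\ell\in S_{2i}}\ell$ for every $i$. The associated balanced trade is the minimal $(v,2(t+1),t)$ trade with blocks $B_\varepsilon=\bigcup_i S_{2i-1+\varepsilon_i}$, $\varepsilon\in\{0,1\}^{t+1}$, where $T^{(1)}$ consists of the $B_\varepsilon$ with $\sum_i\varepsilon_i$ even and $T^{(2)}$ of those with $\sum_i\varepsilon_i$ odd (all blocks have equal block-sum). A collection of popularity swaps of magnitude $p$ is a set of pairwise disjoint transpositions $(a,b)$ of $[v]$ (no element in two of them) with $1\le|a-b|\le p$; with $\pi$ their product and $S'_j=\pi(S_j)$, the total set discrepancy under popularity changes of magnitude $p$ is the maximum over all such swap collections of $\sum_{i=1}^{t+1}\left|\sum_{x\in S'_{2i}}x-\sum_{x\in S'_{2i-1}}x\right|$. -}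

module Defs where

open import Data.Nat using (ℕ; zero; suc; _+_; _*_; _∸_; _≤_; _/_; ∣_-_∣)
open import Data.Fin using (Fin; toℕ) renaming (zero to f0; suc to fs)
open import Data.Fin.Permutation.Components using (transpose)
open import Data.Nat.ListAction using (sum)
open import Data.List using (List; []; _∷_; map; allFin; foldr; concatMap)
open import Data.List.Relation.Unary.All using (All)
open import Data.List.Relation.Unary.Unique.Propositional using (Unique)
open import Data.Product using (Σ; ∃; _×_; _,_; proj₁; proj₂)
open import Data.Integer using (ℤ; +_; -[1+_])
open import Relation.Binary.PropositionalEquality using (_≡_)

-- The ground set [v] = {1,…,v} is represented by Fin v, element x ↦ value toℕ x + 1.
val : ∀ {v} → Fin v → ℕ
val x = suc (toℕ x)

-- A family of 2(t+1) two-element sets grouped into t+1 companion pairs: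
-- S i ε j is the j-th element (j ∈ {0,1}) of the set S_{2i-1+ε} (i ∈ {0..t}, ε ∈ {0,1}).
Collection : ℕ → ℕ → Set
Collection t v = Fin (suc t) → Fin 2 → Fin 2 → Fin v

sumSet : ∀ {v} → (Fin v → Fin v) → (Fin 2 → Fin v) → ℕ
sumSet π s = val (π (s f0)) + val (π (s (fs f0)))

-- Balanced companion collection on [v], v = 4(t+1):
-- the 4(t+1) entries form a partition of [v] into sets of size 2 (the map (i,ε,j) ↦ S i ε j is a
-- bijection onto Fin v: injective gives disjointness and each set has exactly 2 elements,
-- surjective gives the cover), and each companion pair has equal sums.
record IsBalancedCompanionCollection (t : ℕ) (S : Collection t (4 * suc t)) : Set where
  field
    injective : ∀ i ε j i′ ε′ j′ → S i ε j ≡ S i′ ε′ j′ → (i ≡ i′) × (ε ≡ ε′) × (j ≡ j′)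
    surjective : ∀ x → ∃ λ i → ∃ λ ε → ∃ λ j → S i ε j ≡ x
    balanced : ∀ i → sumSet (λ x → x) (S i f0) ≡ sumSet (λ x → x) (S i (fs f0))

endpoints : ∀ {v} → List (Fin v × Fin v) → List (Fin v)
endpoints = concatMap (λ ab → proj₁ ab ∷ proj₂ ab ∷ [])

record IsSwapCollection {v : ℕ} (p : ℕ) (sw : List (Fin v × Fin v)) : Set where
  field
    magnitude : All (λ ab → (1 ≤ ∣ toℕ (proj₁ ab) - toℕ (proj₂ ab) ∣) × (∣ toℕ (proj₁ ab) - toℕ (proj₂ ab) ∣ ≤ p)) sw
    disjoint : Unique (endpoints sw)

perm : ∀ {v} → List (Fin v × Fin v) → Fin v → Fin v
perm sw x = foldr (λ ab y → transpose (proj₁ ab) (proj₂ ab) y) x sw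

discrepancy : ∀ {t v} → Collection t v → List (Fin v × Fin v) → ℕ
discrepancy {t} S sw =
  sum (map (λ i → ∣ sumSet (perm sw) (S i (fs f0)) - sumSet (perm sw) (S i f0) ∣) (allFin (suc t)))

TotalSetDiscrepancy : ∀ {t v} → Collection t v → ℕ → ℕ → Set
TotalSetDiscrepancy {t} {v} S p D =
  (Σ (List (Fin v × Fin v)) λ sw → IsSwapCollection p sw × (discrepancy S sw ≡ D))
  × (∀ (sw : List (Fin v × Fin v)) → IsSwapCollection p sw → discrepancy S sw ≤ D)

-- Δ as a function of m' ∈ {0,4,8,12,16,20} (other values do not occur)
Δ : ℕ → ℤ
Δ 0 = -[1+ 1 ]
Δ 4 = + 2
Δ 8 = + 4
Δ 12 = + 6
Δ 16 = + 6
Δ 20 = + 8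
Δ _ = + 0

module Submission where

-- A swap collection of magnitude 1 is a product of disjoint transpositions (x, x+1), so every
-- displacement d(x) = π(x) − x lies in {−1, 0, 1}, and d(x) = 1 exactly when d(x+1) = −1. As the
-- two sets of a companion pair have equal sums, the discrepancy of a pair is the absolute value of
-- a linear form in d. Writing each absolute value with its sign, the total discrepancy becomes a
-- maximum, over sign patterns, of linear forms in d, and each of these is maximised over the
-- admissible d by a dynamic program running along 0, 1, …, v − 1.
--
-- The collection consists of shifted copies of a block of six pairs on 24 elements followed by one
-- of six short tail blocks. For each block the dynamic program certifies the bound
-- c + [a swap crosses its left end] − [a swap crosses its right end], where c is the value of the
-- block (12 for the repeated one); these bounds telescope along the concatenation, and explicit swap
-- collections attain the sum of the values.

open import Defs
open import Data.Nat using (ℕ; zero; suc; _+_; _*_; _∸_; _/_; _%_; _≤_; _<_; _≟_; _<?_; _≡ᵇ_; _<ᵇ_;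
                            ∣_-_∣; NonZero; s≤s; z<s; s<s)
import Data.Nat.Properties as ℕ
open import Data.Nat.DivMod using (_mod_; m<n⇒m%n≡m; m%n<n; m≡m%n+[m/n]*n)
open import Data.Nat.ListAction using (sum)
open import Data.Nat.Solver using () renaming (module +-*-Solver to ℕ-Solver)
open import Data.Integer using (ℤ; +_; -[1+_]; ∣_∣; -_; _⊖_; _⊔_; _≤ᵇ_; 0ℤ; 1ℤ; -1ℤ)
  renaming (_+_ to _+ℤ_; _-_ to _-ℤ_; _*_ to _*ℤ_; _≤_ to _≤ℤ_)
import Data.Integer.Properties as ℤ
open import Data.Integer.Solver using () renaming (module +-*-Solver to ℤ-Solver)
open import Algebra.Properties.CommutativeSemigroup ℕ.+-commutativeSemigroup using ()
  renaming (interchange to +-interchangeℕ)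
open import Algebra.Properties.CommutativeSemigroup ℤ.+-commutativeSemigroup using ()
  renaming (interchange to +-interchangeℤ)
open import Data.Fin using (Fin; toℕ; fromℕ<)
import Data.Fin.Properties as Fin
open import Data.Fin.Patterns using (0F; 1F)
open import Data.Fin.Permutation.Components using (transpose)
open import Data.Bool using (Bool; true; false; T; if_then_else_)
open import Data.Bool.Properties using (T-≡)
open import Data.Bool.ListAction using (all)
open import Data.List using (List; []; _∷_; _++_; map; foldr; concatMap; length; upTo; allFin; tabulate)
import Data.List.Properties as List
open import Data.List.Relation.Unary.All as All using (All; []; _∷_)
import Data.List.Relation.Unary.All.Properties as All
open import Data.List.Relation.Unary.Any using (here; there)
open import Data.List.Relation.Unary.AllPairs using ([]; _∷_)
import Data.List.Relation.Unary.AllPairs.Properties as AllPairs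
open import Data.List.Relation.Unary.Unique.Propositional using (Unique)
import Data.List.Relation.Unary.Unique.Propositional.Properties as Unique
open import Data.List.Relation.Unary.Unique.DecPropositional _≟_ using (unique?)
open import Data.List.Membership.Propositional using (_∈_; _∉_)
open import Data.List.Membership.Propositional.Properties
  using (∈-map⁺; ∈-map⁻; ∈-++⁺ˡ; ∈-++⁺ʳ; ∈-upTo⁺; ∈-allFin)
open import Data.List.Membership.DecPropositional _≟_ using (_∈?_)
open import Data.Product using (Σ; ∃; _×_; _,_; proj₁; proj₂)
open import Data.Product.Properties using (≡-dec)
open import Data.Sum using (_⊎_; inj₁; inj₂)
open import Function using (_∘_; id; case_of_; Equivalence)
open import Relation.Nullary using (Dec; yes; no; does; contradiction)
open import Relation.Nullary.Decidable using (isYes; toWitness; dec-true; dec-false)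
open import Relation.Binary.PropositionalEquality

-- Adjacent transpositions

transposeℕ : ℕ → ℕ → ℕ → ℕ
transposeℕ a b x with x ≟ a | x ≟ b
... | yes _ | _     = b
... | no _  | yes _ = a
... | no _  | no _  = x

transposeℕ-left : ∀ a b → transposeℕ a b a ≡ b
transposeℕ-left a b with a ≟ a | a ≟ b
... | yes _   | _ = refl
... | no a≢a  | _ = contradiction refl a≢a

transposeℕ-right : ∀ a b → transposeℕ a b b ≡ a
transposeℕ-right a b with b ≟ a | b ≟ b
... | yes refl | _       = refl
... | no _     | yes _   = refl
... | no _     | no b≢b  = contradiction refl b≢b

transposeℕ-other : ∀ {a b x} → x ≢ a → x ≢ b → transposeℕ a b x ≡ x
transposeℕ-other {a} {b} {x} x≢a x≢b with x ≟ a | x ≟ b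
... | yes x≡a | _       = contradiction x≡a x≢a
... | no _    | yes x≡b = contradiction x≡b x≢b
... | no _    | no _    = refl

transposeℕ-+ : ∀ m a b x → transposeℕ (m + a) (m + b) (m + x) ≡ m + transposeℕ a b x
transposeℕ-+ m a b x with x ≟ a | x ≟ b
... | yes refl | _        = transposeℕ-left (m + x) (m + b)
... | no _     | yes refl = transposeℕ-right (m + a) (m + x)
... | no x≢a   | no x≢b   = transposeℕ-other (x≢a ∘ ℕ.+-cancelˡ-≡ m x a) (x≢b ∘ ℕ.+-cancelˡ-≡ m x b)

toℕ-transpose : ∀ {n} (i j k : Fin n) → toℕ (transpose i j k) ≡ transposeℕ (toℕ i) (toℕ j) (toℕ k)
toℕ-transpose i j k with k Fin.≟ i
... | yes refl = sym (transposeℕ-left (toℕ k) (toℕ j))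
... | no k≢i with k Fin.≟ j
...   | yes refl = sym (transposeℕ-right (toℕ i) (toℕ k))
...   | no k≢j = sym (transposeℕ-other (k≢i ∘ Fin.toℕ-injective) (k≢j ∘ Fin.toℕ-injective))

applySwaps : List (ℕ × ℕ) → ℕ → ℕ
applySwaps sw x = foldr (λ ab → transposeℕ (proj₁ ab) (proj₂ ab)) x sw

endpointsℕ : List (ℕ × ℕ) → List ℕ
endpointsℕ = concatMap (λ ab → proj₁ ab ∷ proj₂ ab ∷ [])

swapsToℕ : ∀ {v} → List (Fin v × Fin v) → List (ℕ × ℕ)
swapsToℕ = map (λ ab → toℕ (proj₁ ab) , toℕ (proj₂ ab))

toℕ-perm : ∀ {v} (sw : List (Fin v × Fin v)) x → toℕ (perm sw x) ≡ applySwaps (swapsToℕ sw) (toℕ x)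
toℕ-perm [] x = refl
toℕ-perm ((a , b) ∷ sw) x =
  trans (toℕ-transpose a b (perm sw x)) (cong (transposeℕ (toℕ a) (toℕ b)) (toℕ-perm sw x))

endpointsℕ-toℕ : ∀ {v} (sw : List (Fin v × Fin v)) → endpointsℕ (swapsToℕ sw) ≡ map toℕ (endpoints sw)
endpointsℕ-toℕ [] = refl
endpointsℕ-toℕ ((a , b) ∷ sw) = cong (λ es → toℕ a ∷ toℕ b ∷ es) (endpointsℕ-toℕ sw)

Neighbour : ℕ → ℕ → Set
Neighbour x y = (y ≡ x) ⊎ (y ≡ suc x) ⊎ (suc y ≡ x)

Adjacent : ℕ × ℕ → Set
Adjacent (a , b) = (b ≡ suc a) ⊎ (a ≡ suc b)

adjacent-neighbours : ∀ {a b} → Adjacent (a , b) → Neighbour a b × Neighbour b a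
adjacent-neighbours (inj₁ b≡1+a) = inj₂ (inj₁ b≡1+a) , inj₂ (inj₂ (sym b≡1+a))
adjacent-neighbours (inj₂ a≡1+b) = inj₂ (inj₂ (sym a≡1+b)) , inj₂ (inj₁ a≡1+b)

record SwapInvariants (sw : List (ℕ × ℕ)) : Set where
  field
    fixes-outside : ∀ {x} → x ∉ endpointsℕ sw → applySwaps sw x ≡ x
    endpoints-closed : ∀ {x} → x ∈ endpointsℕ sw → applySwaps sw x ∈ endpointsℕ sw
    involutive : ∀ x → applySwaps sw (applySwaps sw x) ≡ x
    neighbour : ∀ x → Neighbour x (applySwaps sw x)

swapInvariants : ∀ sw → All Adjacent sw → Unique (endpointsℕ sw) → SwapInvariants sw
swapInvariants [] _ _ = record
  { fixes-outside = λ _ → refl ; endpoints-closed = λ () ; involutive = λ _ → refl ; neighbour = λ _ → inj₁ refl }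
swapInvariants ((a , b) ∷ sw) (adj ∷ adjs) ((_ ∷ a∉E) ∷ b∉E ∷ unique) = record
  { fixes-outside = fixes-outside′ ; endpoints-closed = endpoints-closed′
  ; involutive = involutive′ ; neighbour = neighbour′ }
  where
  open SwapInvariants (swapInvariants sw adjs unique)
  E = endpointsℕ sw
  p = applySwaps sw
  q = applySwaps ((a , b) ∷ sw)

  q-a : q a ≡ b
  q-a = trans (cong (transposeℕ a b) (fixes-outside (All.All¬⇒¬Any a∉E))) (transposeℕ-left a b)

  q-b : q b ≡ a
  q-b = trans (cong (transposeℕ a b) (fixes-outside (All.All¬⇒¬Any b∉E))) (transposeℕ-right a b)

  q-inside : ∀ {x} → x ∈ E → q x ≡ p x
  q-inside x∈E = transposeℕ-other (λ { refl → All.All¬⇒¬Any a∉E (endpoints-closed x∈E) })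
                                  (λ { refl → All.All¬⇒¬Any b∉E (endpoints-closed x∈E) })

  fixes-outside′ : ∀ {x} → x ∉ a ∷ b ∷ E → q x ≡ x
  fixes-outside′ x∉ = trans (cong (transposeℕ a b) (fixes-outside (x∉ ∘ there ∘ there)))
                            (transposeℕ-other (x∉ ∘ here) (x∉ ∘ there ∘ here))

  endpoints-closed′ : ∀ {x} → x ∈ a ∷ b ∷ E → q x ∈ a ∷ b ∷ E
  endpoints-closed′ (here refl) = there (here q-a)
  endpoints-closed′ (there (here refl)) = here q-b
  endpoints-closed′ (there (there x∈E)) rewrite q-inside x∈E = there (there (endpoints-closed x∈E))

  involutive′ : ∀ x → q (q x) ≡ x
  involutive′ x with x ∈? a ∷ b ∷ E
  ... | yes (here refl) = trans (cong q q-a) q-b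
  ... | yes (there (here refl)) = trans (cong q q-b) q-a
  ... | yes (there (there x∈E)) =
    trans (cong q (q-inside x∈E)) (trans (q-inside (endpoints-closed x∈E)) (involutive x))
  ... | no x∉ = trans (cong q (fixes-outside′ x∉)) (fixes-outside′ x∉)

  neighbour′ : ∀ x → Neighbour x (q x)
  neighbour′ x with x ∈? a ∷ b ∷ E
  ... | yes (here refl) rewrite q-a = proj₁ (adjacent-neighbours adj)
  ... | yes (there (here refl)) rewrite q-b = proj₂ (adjacent-neighbours adj)
  ... | yes (there (there x∈E)) rewrite q-inside x∈E = neighbour x
  ... | no x∉ = inj₁ (fixes-outside′ x∉)

shiftSwap : ℕ → ℕ × ℕ → ℕ × ℕ
shiftSwap m (a , b) = m + a , m + b

applySwaps-shift : ∀ m sw x → applySwaps (map (shiftSwap m) sw) (m + x) ≡ m + applySwaps sw x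
applySwaps-shift m [] x = refl
applySwaps-shift m ((a , b) ∷ sw) x =
  trans (cong (transposeℕ (m + a) (m + b)) (applySwaps-shift m sw x)) (transposeℕ-+ m a b (applySwaps sw x))

applySwaps-shift-below : ∀ m sw {x} → x < m → applySwaps (map (shiftSwap m) sw) x ≡ x
applySwaps-shift-below m [] x<m = refl
applySwaps-shift-below m ((a , b) ∷ sw) {x} x<m =
  trans (cong (transposeℕ (m + a) (m + b)) (applySwaps-shift-below m sw x<m))
        (transposeℕ-other (ℕ.<⇒≢ (ℕ.<-≤-trans x<m (ℕ.m≤m+n m a)))
                           (ℕ.<⇒≢ (ℕ.<-≤-trans x<m (ℕ.m≤m+n m b))))

applySwaps-++ : ∀ sw sw′ x → applySwaps (sw ++ sw′) x ≡ applySwaps sw (applySwaps sw′ x)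
applySwaps-++ sw sw′ x = List.foldr-++ _ x sw sw′

endpointsℕ-++ : ∀ sw sw′ → endpointsℕ (sw ++ sw′) ≡ endpointsℕ sw ++ endpointsℕ sw′
endpointsℕ-++ [] sw′ = refl
endpointsℕ-++ ((a , b) ∷ sw) sw′ = cong (λ es → a ∷ b ∷ es) (endpointsℕ-++ sw sw′)

endpointsℕ-shift : ∀ m sw → endpointsℕ (map (shiftSwap m) sw) ≡ map (λ z → m + z) (endpointsℕ sw)
endpointsℕ-shift m [] = refl
endpointsℕ-shift m ((a , b) ∷ sw) = cong (λ es → m + a ∷ m + b ∷ es) (endpointsℕ-shift m sw)

-- Displacements and the path dynamic program

displacement : (ℕ → ℕ) → ℕ → ℤ
displacement p x = p x ⊖ x

movedDown : (ℕ → ℕ) → ℕ → Bool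
movedDown p x = does (suc (p x) ≟ x)

-- down j records whether j is swapped with j − 1.
Admissible : (ℕ → ℤ) → (ℕ → Bool) → ℕ → Set
Admissible e down j =
    (down j ≡ true  × down (suc j) ≡ false × e j ≡ -1ℤ)
  ⊎ (down j ≡ false × down (suc j) ≡ true  × e j ≡ 1ℤ)
  ⊎ (down j ≡ false × down (suc j) ≡ false × e j ≡ 0ℤ)

1+n⊖n≡1 : ∀ n → suc n ⊖ n ≡ 1ℤ
1+n⊖n≡1 n = trans (ℤ.⊖-≥ (ℕ.n≤1+n n)) (cong +_ (ℕ.m+n∸n≡m 1 n))

n⊖1+n≡-1 : ∀ n → n ⊖ suc n ≡ -1ℤ
n⊖1+n≡-1 n = trans (ℤ.⊖-swap n (suc n)) (cong -_ (1+n⊖n≡1 n))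

2+n≢n : ∀ n → suc (suc n) ≢ n
2+n≢n n = ℕ.m≢1+n+m n {1} ∘ sym

involution-swap : ∀ (p : ℕ → ℕ) → (∀ x → p (p x) ≡ x) → ∀ {x y} → p y ≡ x → p x ≡ y
involution-swap p involutive {y = y} py≡x = trans (cong p (sym py≡x)) (involutive y)

neighbour-involution-admissible : ∀ p → (∀ x → p (p x) ≡ x) → (∀ x → Neighbour x (p x)) →
                                   ∀ x → Admissible (displacement p) (movedDown p) x
neighbour-involution-admissible p involutive neighbour x with neighbour x
... | inj₁ px≡x = inj₂ (inj₂ (not-down-x , not-down-1+x , e≡0))
  where
  not-down-x = dec-false (suc (p x) ≟ x) (λ eq → ℕ.1+n≢n (trans (cong suc (sym px≡x)) eq))
  not-down-1+x = dec-false (suc (p (suc x)) ≟ suc x)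
    (λ eq → ℕ.1+n≢n (trans (sym (involution-swap p involutive (ℕ.suc-injective eq))) px≡x))
  e≡0 = trans (cong (_⊖ x) px≡x) (ℤ.n⊖n≡0 x)
... | inj₂ (inj₁ px≡1+x) = inj₂ (inj₁ (not-down-x , down-1+x , e≡1))
  where
  not-down-x = dec-false (suc (p x) ≟ x) (λ eq → 2+n≢n x (trans (cong suc (sym px≡1+x)) eq))
  down-1+x = dec-true (suc (p (suc x)) ≟ suc x) (cong suc (involution-swap p involutive px≡1+x))
  e≡1 = trans (cong (_⊖ x) px≡1+x) (1+n⊖n≡1 x)
... | inj₂ (inj₂ 1+px≡x) = inj₁ (down-x , not-down-1+x , e≡-1)
  where
  down-x = dec-true (suc (p x) ≟ x) 1+px≡x
  not-down-1+x = dec-false (suc (p (suc x)) ≟ suc x)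
    (λ eq → 2+n≢n x (trans (cong suc (sym (involution-swap p involutive (ℕ.suc-injective eq)))) 1+px≡x))
  e≡-1 = trans (cong (p x ⊖_) (sym 1+px≡x)) (n⊖1+n≡-1 (p x))

∑ : ℕ → (ℕ → ℤ) → ℤ
∑ zero f = 0ℤ
∑ (suc n) f = f 0 +ℤ ∑ n (f ∘ suc)

∑-cong : ∀ n {f g : ℕ → ℤ} → (∀ {i} → i < n → f i ≡ g i) → ∑ n f ≡ ∑ n g
∑-cong zero _ = refl
∑-cong (suc n) f≗g = cong₂ _+ℤ_ (f≗g z<s) (∑-cong n (f≗g ∘ s<s))

∑-zero : ∀ n {f : ℕ → ℤ} → (∀ i → f i ≡ 0ℤ) → ∑ n f ≡ 0ℤ
∑-zero zero _ = refl
∑-zero (suc n) f≗0 = cong₂ _+ℤ_ (f≗0 0) (∑-zero n (f≗0 ∘ suc))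

∑-+ : ∀ n (f g : ℕ → ℤ) → ∑ n (λ i → f i +ℤ g i) ≡ ∑ n f +ℤ ∑ n g
∑-+ zero f g = refl
∑-+ (suc n) f g =
  trans (cong ((f 0 +ℤ g 0) +ℤ_) (∑-+ n (f ∘ suc) (g ∘ suc))) (+-interchangeℤ (f 0) (g 0) _ _)

∑-split : ∀ m n (f : ℕ → ℤ) → ∑ (m + n) f ≡ ∑ m f +ℤ ∑ n (λ i → f (m + i))
∑-split zero n f = sym (ℤ.+-identityˡ _)
∑-split (suc m) n f = trans (cong (f 0 +ℤ_) (∑-split m n (f ∘ suc))) (sym (ℤ.+-assoc (f 0) _ _))

∑-snoc : ∀ n (f : ℕ → ℤ) → ∑ (suc n) f ≡ ∑ n f +ℤ f n
∑-snoc zero f = trans (ℤ.+-identityʳ (f 0)) (sym (ℤ.+-identityˡ (f 0)))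
∑-snoc (suc n) f = trans (cong (f 0 +ℤ_) (∑-snoc n (f ∘ suc))) (sym (ℤ.+-assoc (f 0) _ _))

δ : ℕ → ℤ → ℕ → ℤ
δ o c j = if o ≡ᵇ j then c else 0ℤ

∑-δ : ∀ n o c (e : ℕ → ℤ) → o < n → ∑ n (λ j → δ o c j *ℤ e j) ≡ c *ℤ e o
∑-δ (suc n) zero c e _ =
  trans (cong (c *ℤ e 0 +ℤ_) (∑-zero n (λ j → ℤ.*-zeroˡ (e (suc j))))) (ℤ.+-identityʳ (c *ℤ e 0))
∑-δ (suc n) (suc o) c e (s<s o<n) =
  trans (cong₂ _+ℤ_ (ℤ.*-zeroˡ (e 0)) (∑-δ n o c (e ∘ suc) o<n)) (ℤ.+-identityˡ (c *ℤ e (suc o)))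

LinearForm : Set
LinearForm = List (ℕ × ℤ)

evaluate : LinearForm → (ℕ → ℤ) → ℤ
evaluate [] e = 0ℤ
evaluate ((o , c) ∷ φ) e = c *ℤ e o +ℤ evaluate φ e

coefficient : LinearForm → ℕ → ℤ
coefficient [] j = 0ℤ
coefficient ((o , c) ∷ φ) j = δ o c j +ℤ coefficient φ j

evaluate-++ : ∀ φ ψ e → evaluate (φ ++ ψ) e ≡ evaluate φ e +ℤ evaluate ψ e
evaluate-++ [] ψ e = sym (ℤ.+-identityˡ _)
evaluate-++ ((o , c) ∷ φ) ψ e = trans (cong (c *ℤ e o +ℤ_) (evaluate-++ φ ψ e)) (sym (ℤ.+-assoc (c *ℤ e o) _ _))

evaluate-as-∑ : ∀ n φ e → All (λ oc → proj₁ oc < n) φ →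
                evaluate φ e ≡ ∑ n (λ j → coefficient φ j *ℤ e j)
evaluate-as-∑ n [] e [] = sym (∑-zero n (λ j → ℤ.*-zeroˡ (e j)))
evaluate-as-∑ n ((o , c) ∷ φ) e (o<n ∷ φ<n) = begin
  c *ℤ e o +ℤ evaluate φ e
    ≡⟨ cong₂ _+ℤ_ (sym (∑-δ n o c e o<n)) (evaluate-as-∑ n φ e φ<n) ⟩
  ∑ n (λ j → δ o c j *ℤ e j) +ℤ ∑ n (λ j → coefficient φ j *ℤ e j)
    ≡⟨ ∑-+ n _ _ ⟨
  ∑ n (λ j → δ o c j *ℤ e j +ℤ coefficient φ j *ℤ e j)
    ≡⟨ ∑-cong n (λ {j} _ → ℤ.*-distribʳ-+ (e j) (δ o c j) (coefficient φ j)) ⟨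
  ∑ n (λ j → (δ o c j +ℤ coefficient φ j) *ℤ e j) ∎
  where open ≡-Reasoning

pick : ℤ × ℤ → Bool → ℤ
pick (v , _) false = v
pick (_ , v) true = v

-- Stands for −∞ (an unreachable state); soundness holds for any value.
-∞ : ℤ
-∞ = -[1+ 999 ]

dpStep : ℤ × ℤ → ℤ → ℤ × ℤ
dpStep (v₀ , v₁) w = v₀ ⊔ (v₁ -ℤ w) , v₀ +ℤ w

-- The two components bound ∑ j < n, w j * e j over admissible e with down 0 = start,
-- for down n = false and down n = true respectively.
maxPath : (ℕ → ℤ) → Bool → ℕ → ℤ × ℤ
maxPath w start zero = if start then (-∞ , 0ℤ) else (0ℤ , -∞)
maxPath w start (suc n) = dpStep (maxPath w start n) (w n)

maxPath-bound : ∀ w e down n → (∀ {j} → j < n → Admissible e down j) →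
                ∑ n (λ j → w j *ℤ e j) ≤ℤ pick (maxPath w (down 0) n) (down n)
maxPath-bound w e down zero _ with down 0
... | true = ℤ.≤-refl
... | false = ℤ.≤-refl
maxPath-bound w e down (suc n) admissible
  rewrite ∑-snoc n (λ j → w j *ℤ e j)
  with admissible {n} (ℕ.n<1+n n) | maxPath-bound w e down n (admissible ∘ ℕ.m<n⇒m<1+n)
... | inj₁ (dn , ¬d1+n , e≡-1) | ih rewrite dn | ¬d1+n | e≡-1 | ℤ.*-comm (w n) -1ℤ | ℤ.-1*i≡-i (w n) =
  ℤ.≤-trans (ℤ.+-monoˡ-≤ (- w n) ih) (ℤ.i≤j⊔i _ _)
... | inj₂ (inj₁ (¬dn , d1+n , e≡1)) | ih rewrite ¬dn | d1+n | e≡1 | ℤ.*-identityʳ (w n) =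
  ℤ.+-monoˡ-≤ (w n) ih
... | inj₂ (inj₂ (¬dn , ¬d1+n , e≡0)) | ih
  rewrite ¬dn | ¬d1+n | e≡0 | ℤ.*-zeroʳ (w n) | ℤ.+-identityʳ (∑ n (λ j → w j *ℤ e j)) =
  ℤ.≤-trans ih (ℤ.i≤i⊔j _ _)

CompanionPair : Set
CompanionPair = Fin 2 → Fin 2 → ℕ

-- ly i ε κ is the κ-th element of the ε-th set of the i-th companion pair, as a 0-based value
-- (Defs.val adds one).
Layout : Set
Layout = ℕ → CompanionPair

pairImbalance : (ℕ → ℤ) → CompanionPair → ℤ
pairImbalance e S = (e (S 1F 0F) +ℤ e (S 1F 1F)) -ℤ (e (S 0F 0F) +ℤ e (S 0F 1F))

imbalance : Layout → ℕ → (ℕ → ℤ) → ℤ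
imbalance ly n e = ∑ n (λ i → + ∣ pairImbalance e (ly i) ∣)

sign : ℤ → ℤ
sign (+ _) = 1ℤ
sign -[1+ _ ] = -1ℤ

∣i∣≡sign[i]*i : ∀ i → + ∣ i ∣ ≡ sign i *ℤ i
∣i∣≡sign[i]*i (+ n) = sym (ℤ.*-identityˡ (+ n))
∣i∣≡sign[i]*i -[1+ n ] = sym (ℤ.-1*i≡-i -[1+ n ])

pairForm : CompanionPair → ℤ → LinearForm
pairForm S s = (S 1F 0F , s) ∷ (S 1F 1F , s) ∷ (S 0F 0F , - s) ∷ (S 0F 1F , - s) ∷ []

evaluate-pairForm : ∀ S s e → evaluate (pairForm S s) e ≡ s *ℤ pairImbalance e S
evaluate-pairForm S s e =
  solve 5 (λ s b c a d → s :* b :+ (s :* c :+ (:- s :* a :+ (:- s :* d :+ con 0ℤ))) := s :* ((b :+ c) :- (a :+ d)))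
    refl s (e (S 1F 0F)) (e (S 1F 1F)) (e (S 0F 0F)) (e (S 0F 1F))
  where open ℤ-Solver

signedForm : Layout → List ℤ → LinearForm
signedForm ly [] = []
signedForm ly (s ∷ σ) = pairForm (ly 0) s ++ signedForm (ly ∘ suc) σ

signsOf : Layout → ℕ → (ℕ → ℤ) → List ℤ
signsOf ly zero e = []
signsOf ly (suc n) e = sign (pairImbalance e (ly 0)) ∷ signsOf (ly ∘ suc) n e

imbalance-signedForm : ∀ ly n e → imbalance ly n e ≡ evaluate (signedForm ly (signsOf ly n e)) e
imbalance-signedForm ly zero e = refl
imbalance-signedForm ly (suc n) e = begin
  + ∣ z ∣ +ℤ imbalance (ly ∘ suc) n e
    ≡⟨ cong₂ _+ℤ_ (trans (∣i∣≡sign[i]*i z) (sym (evaluate-pairForm (ly 0) (sign z) e)))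
                 (imbalance-signedForm (ly ∘ suc) n e) ⟩
  evaluate (pairForm (ly 0) (sign z)) e +ℤ evaluate (signedForm (ly ∘ suc) (signsOf (ly ∘ suc) n e)) e
    ≡⟨ evaluate-++ (pairForm (ly 0) (sign z)) (signedForm (ly ∘ suc) (signsOf (ly ∘ suc) n e)) e ⟨
  evaluate (signedForm ly (signsOf ly (suc n) e)) e ∎
  where
  open ≡-Reasoning
  z = pairImbalance e (ly 0)

allSigns : ℕ → List (List ℤ)
allSigns zero = [] ∷ []
allSigns (suc n) = map (1ℤ ∷_) (allSigns n) ++ map (-1ℤ ∷_) (allSigns n)

signsOf∈allSigns : ∀ ly n e → signsOf ly n e ∈ allSigns n
signsOf∈allSigns ly zero e = here refl
signsOf∈allSigns ly (suc n) e with pairImbalance e (ly 0)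
... | + _ = ∈-++⁺ˡ (∈-map⁺ (1ℤ ∷_) (signsOf∈allSigns (ly ∘ suc) n e))
... | -[1+ _ ] = ∈-++⁺ʳ (map (1ℤ ∷_) (allSigns n)) (∈-map⁺ (-1ℤ ∷_) (signsOf∈allSigns (ly ∘ suc) n e))

signedForm-< : ∀ {len} ly σ → (∀ {i} ε κ → i < length σ → ly i ε κ < len) →
               All (λ oc → proj₁ oc < len) (signedForm ly σ)
signedForm-< ly [] _ = []
signedForm-< ly (s ∷ σ) ly<len =
  All.++⁺ (ly<len 1F 0F z<s ∷ ly<len 1F 1F z<s ∷ ly<len 0F 0F z<s ∷ ly<len 0F 1F z<s ∷ [])
      (signedForm-< (ly ∘ suc) σ (λ ε κ → ly<len ε κ ∘ s<s))

length-signsOf : ∀ ly n e → length (signsOf ly n e) ≡ n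
length-signsOf ly zero e = refl
length-signsOf ly (suc n) e = cong suc (length-signsOf (ly ∘ suc) n e)

boundCheck : Layout → (n len : ℕ) → Bool → (Bool → ℤ) → Bool
boundCheck ly n len r bound =
  all (λ σ → all (λ l → pick (maxPath (coefficient (signedForm ly σ)) l len) r ≤ᵇ bound l) (true ∷ false ∷ []))
      (allSigns n)

boundCheck-sound : ∀ ly n len r bound → T (boundCheck ly n len r bound) →
  (∀ {i} ε κ → i < n → ly i ε κ < len) →
  ∀ e down → (∀ {j} → j < len → Admissible e down j) → down len ≡ r → imbalance ly n e ≤ℤ bound (down 0)
boundCheck-sound ly n len r bound check ly<len e down admissible refl = begin
  imbalance ly n e                                    ≡⟨ imbalance-signedForm ly n e ⟩
  evaluate φ e                                        ≡⟨ evaluate-as-∑ len φ e (signedForm-< ly σ ly<len′) ⟩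
  ∑ len (λ j → coefficient φ j *ℤ e j)                 ≤⟨ maxPath-bound (coefficient φ) e down len admissible ⟩
  pick (maxPath (coefficient φ) (down 0) len) (down len) ≤⟨ ℤ.≤ᵇ⇒≤ (All.lookup checkσ (bool∈ (down 0))) ⟩
  bound (down 0) ∎
  where
  open ℤ.≤-Reasoning
  σ = signsOf ly n e
  φ = signedForm ly σ
  ly<len′ : ∀ {i} ε κ → i < length σ → ly i ε κ < len
  ly<len′ ε κ i<len = ly<len ε κ (subst (_ <_) (length-signsOf ly n e) i<len)
  withinBound : List ℤ → Bool → Bool
  withinBound σ l = pick (maxPath (coefficient (signedForm ly σ)) l len) r ≤ᵇ bound l
  withinBounds : List ℤ → Bool
  withinBounds σ = all (withinBound σ) (true ∷ false ∷ [])
  checkσ = All.all⁺ (withinBound σ) (true ∷ false ∷ [])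
             (All.lookup (All.all⁺ withinBounds (allSigns n) check) (signsOf∈allSigns ly n e))
  bool∈ : ∀ b → b ∈ true ∷ false ∷ []
  bool∈ true = here refl
  bool∈ false = there (here refl)

-- Blocks and their concatenation

Position : Set
Position = ℕ × Fin 2 × Fin 2

record Block : Set where
  field
    pairs size : ℕ
    layout : Layout
    locate : ℕ → Position
    extremal : List (ℕ × ℕ)

open Block

elementAt : Layout → Position → ℕ
elementAt ly (i , ε , κ) = ly i ε κ

elementAt-cong : ∀ {ly : Layout} {S : CompanionPair} P → ly (proj₁ P) ≡ S →
                 elementAt ly P ≡ S (proj₁ (proj₂ P)) (proj₂ (proj₂ P))
elementAt-cong (i , ε , κ) ly≡S = cong (λ S → S ε κ) ly≡S

elementSum : (Fin 2 → ℕ) → ℕ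
elementSum s = s 0F + s 1F

Balanced : CompanionPair → Set
Balanced S = elementSum (S 0F) ≡ elementSum (S 1F)

record IsPartition (B : Block) : Set where
  field
    layout-< : ∀ {i} ε κ → i < pairs B → layout B i ε κ < size B
    locate-layout : ∀ {i} ε κ → i < pairs B → locate B (layout B i ε κ) ≡ (i , ε , κ)
    locate-< : ∀ {x} → x < size B → proj₁ (locate B x) < pairs B
    layout-locate : ∀ {x} → x < size B → elementAt (layout B) (locate B x) ≡ x
    balanced : ∀ {i} → i < pairs B → Balanced (layout B i)

record IsSwapSet (size : ℕ) (sw : List (ℕ × ℕ)) : Set where
  field
    rising : All (λ ab → proj₂ ab ≡ suc (proj₁ ab)) sw
    within : All (λ ab → proj₂ ab < size) sw
    distinct : Unique (endpointsℕ sw)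

Attains : Block → ℕ → Set
Attains B c = imbalance (layout B) (pairs B) (displacement (applySwaps (extremal B))) ≡ + c

bit : Bool → ℕ
bit true = 1
bit false = 0

-- A swap across the left end of a block may add one to its imbalance; one across its right end
-- is paid for by the next block.
BoundedAt : Block → ℕ → Bool → Set
BoundedAt B c r = ∀ e down → (∀ {j} → j < size B → Admissible e down j) → down (size B) ≡ r →
  imbalance (layout B) (pairs B) e +ℤ + bit r ≤ℤ + c +ℤ + bit (down 0)

shiftPair : ℕ → CompanionPair → CompanionPair
shiftPair m S ε κ = m + S ε κ

shiftPosition : ℕ → Position → Position
shiftPosition m (i , p) = m + i , p

_⊕_ : Block → Block → Block
B ⊕ C = record
  { pairs = pairs B + pairs C
  ; size = size B + size C
  ; layout = λ i → if i <ᵇ pairs B then layout B i else shiftPair (size B) (layout C (i ∸ pairs B))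
  ; locate = λ x → if x <ᵇ size B then locate B x else shiftPosition (pairs B) (locate C (x ∸ size B))
  ; extremal = extremal B ++ map (shiftSwap (size B)) (extremal C)
  }

data Split (m : ℕ) : ℕ → Set where
  below : ∀ {i} → i < m → Split m i
  above : ∀ j → Split m (m + j)

split : ∀ m i → Split m i
split m i with i <? m
... | yes i<m = below i<m
... | no i≮m = subst (Split m) (ℕ.m+[n∸m]≡n (ℕ.≮⇒≥ i≮m)) (above (i ∸ m))

<ᵇ-true : ∀ {i n} → i < n → (i <ᵇ n) ≡ true
<ᵇ-true i<n = Equivalence.to T-≡ (ℕ.<⇒<ᵇ i<n)

+<ᵇ-false : ∀ m j → (m + j <ᵇ m) ≡ false
+<ᵇ-false zero j = refl
+<ᵇ-false (suc m) j = +<ᵇ-false m j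

module _ (B C : Block) where

  layout-⊕ˡ : ∀ {i} → i < pairs B → layout (B ⊕ C) i ≡ layout B i
  layout-⊕ˡ {i} i<p =
    cong (λ b → if b then layout B i else shiftPair (size B) (layout C (i ∸ pairs B))) (<ᵇ-true i<p)

  layout-⊕ʳ : ∀ j → layout (B ⊕ C) (pairs B + j) ≡ shiftPair (size B) (layout C j)
  layout-⊕ʳ j = trans
    (cong (λ b → if b then layout B (pairs B + j) else shiftPair (size B) (layout C (pairs B + j ∸ pairs B)))
          (+<ᵇ-false (pairs B) j))
    (cong (shiftPair (size B) ∘ layout C) (ℕ.m+n∸m≡n (pairs B) j))

  locate-⊕ˡ : ∀ {x} → x < size B → locate (B ⊕ C) x ≡ locate B x
  locate-⊕ˡ {x} x<s =
    cong (λ b → if b then locate B x else shiftPosition (pairs B) (locate C (x ∸ size B))) (<ᵇ-true x<s)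

  locate-⊕ʳ : ∀ y → locate (B ⊕ C) (size B + y) ≡ shiftPosition (pairs B) (locate C y)
  locate-⊕ʳ y = trans
    (cong (λ b → if b then locate B (size B + y) else shiftPosition (pairs B) (locate C (size B + y ∸ size B)))
          (+<ᵇ-false (size B) y))
    (cong (shiftPosition (pairs B) ∘ locate C) (ℕ.m+n∸m≡n (size B) y))

  module _ (PB : IsPartition B) (PC : IsPartition C) where
    module PB = IsPartition PB
    module PC = IsPartition PC

    ⊕-layout-< : ∀ {i} ε κ → i < pairs B + pairs C → layout (B ⊕ C) i ε κ < size B + size C
    ⊕-layout-< {i} ε κ i<p with split (pairs B) i
    ... | below i<pB = subst (λ S → S ε κ < size B + size C) (sym (layout-⊕ˡ i<pB))
                              (ℕ.<-≤-trans (PB.layout-< ε κ i<pB) (ℕ.m≤m+n (size B) (size C)))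
    ... | above j = subst (λ S → S ε κ < size B + size C) (sym (layout-⊕ʳ j))
                          (ℕ.+-monoʳ-< (size B) (PC.layout-< ε κ (ℕ.+-cancelˡ-< (pairs B) j (pairs C) i<p)))

    ⊕-locate-layout : ∀ {i} ε κ → i < pairs B + pairs C →
                      locate (B ⊕ C) (layout (B ⊕ C) i ε κ) ≡ (i , ε , κ)
    ⊕-locate-layout {i} ε κ i<p with split (pairs B) i
    ... | below i<pB = begin
      locate (B ⊕ C) (layout (B ⊕ C) i ε κ) ≡⟨ cong (λ S → locate (B ⊕ C) (S ε κ)) (layout-⊕ˡ i<pB) ⟩
      locate (B ⊕ C) (layout B i ε κ)       ≡⟨ locate-⊕ˡ (PB.layout-< ε κ i<pB) ⟩
      locate B (layout B i ε κ)             ≡⟨ PB.locate-layout ε κ i<pB ⟩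
      (i , ε , κ)                           ∎
      where open ≡-Reasoning
    ... | above j = begin
      locate (B ⊕ C) (layout (B ⊕ C) (pairs B + j) ε κ)
        ≡⟨ cong (λ S → locate (B ⊕ C) (S ε κ)) (layout-⊕ʳ j) ⟩
      locate (B ⊕ C) (size B + layout C j ε κ)
        ≡⟨ locate-⊕ʳ (layout C j ε κ) ⟩
      shiftPosition (pairs B) (locate C (layout C j ε κ))
        ≡⟨ cong (shiftPosition (pairs B)) (PC.locate-layout ε κ j<pC) ⟩
      (pairs B + j , ε , κ) ∎
      where
      open ≡-Reasoning
      j<pC = ℕ.+-cancelˡ-< (pairs B) j (pairs C) i<p

    ⊕-locate-< : ∀ {x} → x < size B + size C → proj₁ (locate (B ⊕ C) x) < pairs B + pairs C
    ⊕-locate-< {x} x<s with split (size B) x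
    ... | below x<sB = subst (λ P → proj₁ P < pairs B + pairs C) (sym (locate-⊕ˡ x<sB))
                             (ℕ.<-≤-trans (PB.locate-< x<sB) (ℕ.m≤m+n (pairs B) (pairs C)))
    ... | above y = subst (λ P → proj₁ P < pairs B + pairs C) (sym (locate-⊕ʳ y))
                          (ℕ.+-monoʳ-< (pairs B) (PC.locate-< (ℕ.+-cancelˡ-< (size B) y (size C) x<s)))

    ⊕-layout-locate : ∀ {x} → x < size B + size C → elementAt (layout (B ⊕ C)) (locate (B ⊕ C) x) ≡ x
    ⊕-layout-locate {x} x<s with split (size B) x
    ... | below x<sB = begin
      elementAt (layout (B ⊕ C)) (locate (B ⊕ C) x) ≡⟨ cong (elementAt (layout (B ⊕ C))) (locate-⊕ˡ x<sB) ⟩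
      elementAt (layout (B ⊕ C)) (locate B x)       ≡⟨ elementAt-cong {layout (B ⊕ C)} (locate B x) (layout-⊕ˡ (PB.locate-< x<sB)) ⟩
      elementAt (layout B) (locate B x)             ≡⟨ PB.layout-locate x<sB ⟩
      x                                             ∎
      where open ≡-Reasoning
    ... | above y = begin
      elementAt (layout (B ⊕ C)) (locate (B ⊕ C) (size B + y))
        ≡⟨ cong (elementAt (layout (B ⊕ C))) (locate-⊕ʳ y) ⟩
      elementAt (layout (B ⊕ C)) (shiftPosition (pairs B) (locate C y))
        ≡⟨ elementAt-cong {layout (B ⊕ C)} (shiftPosition (pairs B) (locate C y)) (layout-⊕ʳ (proj₁ (locate C y))) ⟩
      size B + elementAt (layout C) (locate C y)
        ≡⟨ cong (λ z → size B + z) (PC.layout-locate (ℕ.+-cancelˡ-< (size B) y (size C) x<s)) ⟩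
      size B + y ∎
      where open ≡-Reasoning

    ⊕-balanced : ∀ {i} → i < pairs B + pairs C → Balanced (layout (B ⊕ C) i)
    ⊕-balanced {i} i<p with split (pairs B) i
    ... | below i<pB = subst Balanced (sym (layout-⊕ˡ i<pB)) (PB.balanced i<pB)
    ... | above j = subst Balanced (sym (layout-⊕ʳ j)) (begin
      (size B + layout C j 0F 0F) + (size B + layout C j 0F 1F) ≡⟨ +-interchangeℕ (size B) _ (size B) _ ⟩
      (size B + size B) + elementSum (layout C j 0F)          ≡⟨ cong (λ z → (size B + size B) + z) balancedC ⟩
      (size B + size B) + elementSum (layout C j 1F)          ≡⟨ +-interchangeℕ (size B) (size B) _ _ ⟩
      (size B + layout C j 1F 0F) + (size B + layout C j 1F 1F) ∎)
      where
      open ≡-Reasoning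
      balancedC = PC.balanced (ℕ.+-cancelˡ-< (pairs B) j (pairs C) i<p)

    ⊕-partition : IsPartition (B ⊕ C)
    ⊕-partition = record
      { layout-< = ⊕-layout-< ; locate-layout = ⊕-locate-layout ; locate-< = ⊕-locate-<
      ; layout-locate = ⊕-layout-locate ; balanced = ⊕-balanced }

  imbalance-⊕ : ∀ e → imbalance (layout (B ⊕ C)) (pairs B + pairs C) e ≡
                      imbalance (layout B) (pairs B) e +ℤ imbalance (layout C) (pairs C) (λ y → e (size B + y))
  imbalance-⊕ e = trans (∑-split (pairs B) (pairs C) _)
    (cong₂ _+ℤ_ (∑-cong (pairs B) (λ i<pB → cong (λ S → + ∣ pairImbalance e S ∣) (layout-⊕ˡ i<pB)))
                (∑-cong (pairs C) (λ {j} _ → cong (λ S → + ∣ pairImbalance e S ∣) (layout-⊕ʳ j))))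

imbalance-cong : ∀ ly n {e e′ : ℕ → ℤ} → (∀ {i} ε κ → i < n → e (ly i ε κ) ≡ e′ (ly i ε κ)) →
                 imbalance ly n e ≡ imbalance ly n e′
imbalance-cong ly n e≗e′ = ∑-cong n (λ i<n → cong (λ z → + ∣ z ∣)
  (cong₂ _-ℤ_ (cong₂ _+ℤ_ (e≗e′ 1F 0F i<n) (e≗e′ 1F 1F i<n))
              (cong₂ _+ℤ_ (e≗e′ 0F 0F i<n) (e≗e′ 0F 1F i<n))))

endpoints-< : ∀ {n} sw → All (λ ab → proj₂ ab ≡ suc (proj₁ ab)) sw → All (λ ab → proj₂ ab < n) sw →
              All (_< n) (endpointsℕ sw)
endpoints-< [] [] [] = []
endpoints-< ((a , _) ∷ sw) (refl ∷ rising) (b<n ∷ within) =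
  ℕ.<-trans (ℕ.n<1+n a) b<n ∷ b<n ∷ endpoints-< sw rising within

⊕-swapSet : ∀ {m n} sw sw′ → IsSwapSet m sw → IsSwapSet n sw′ →
            IsSwapSet (m + n) (sw ++ map (shiftSwap m) sw′)
⊕-swapSet {m} {n} sw sw′ S S′ = record
  { rising = All.++⁺ S.rising (All.map⁺ (All.map shift-rising S′.rising))
  ; within = All.++⁺ (All.map (λ b<m → ℕ.<-≤-trans b<m (ℕ.m≤m+n m n)) S.within)
                     (All.map⁺ (All.map (ℕ.+-monoʳ-< m) S′.within))
  ; distinct = subst Unique (sym endpoints≡)
                     (AllPairs.++⁺ S.distinct (Unique.map⁺ (ℕ.+-cancelˡ-≡ m _ _) S′.distinct) apart)
  }
  where
  module S = IsSwapSet S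
  module S′ = IsSwapSet S′
  shift-rising : ∀ {ab} → proj₂ ab ≡ suc (proj₁ ab) → m + proj₂ ab ≡ suc (m + proj₁ ab)
  shift-rising {a , _} refl = ℕ.+-suc m a
  endpoints≡ : endpointsℕ (sw ++ map (shiftSwap m) sw′) ≡ endpointsℕ sw ++ map (λ z → m + z) (endpointsℕ sw′)
  endpoints≡ = trans (endpointsℕ-++ sw (map (shiftSwap m) sw′)) (cong (endpointsℕ sw ++_) (endpointsℕ-shift m sw′))
  apart : All (λ x → All (x ≢_) (map (λ z → m + z) (endpointsℕ sw′))) (endpointsℕ sw)
  apart = All.map (λ x<m → All.map⁺ (All.universal (λ z → ℕ.<⇒≢ (ℕ.<-≤-trans x<m (ℕ.m≤m+n m z))) (endpointsℕ sw′)))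
                  (endpoints-< sw S.rising S.within)

admissible-shift : ∀ m {e down j} → Admissible e down (m + j) → Admissible (λ y → e (m + y)) (λ y → down (m + y)) j
admissible-shift m {down = down} {j} = λ where
    (inj₁ (d , ¬d′ , e≡)) → inj₁ (d , shift ¬d′ , e≡)
    (inj₂ (inj₁ (¬d , d′ , e≡))) → inj₂ (inj₁ (¬d , shift d′ , e≡))
    (inj₂ (inj₂ (¬d , ¬d′ , e≡))) → inj₂ (inj₂ (¬d , shift ¬d′ , e≡))
  where
  shift : ∀ {b} → down (suc (m + j)) ≡ b → down (m + suc j) ≡ b
  shift = trans (cong down (ℕ.+-suc m j))

telescope : ∀ x y a c l m r → x +ℤ m ≤ℤ a +ℤ l → y +ℤ r ≤ℤ c +ℤ m →
            (x +ℤ y) +ℤ r ≤ℤ (a +ℤ c) +ℤ l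
telescope x y a c l m r h₁ h₂ = begin
  (x +ℤ y) +ℤ r
    ≡⟨ solve 4 (λ x y r m → (x :+ y) :+ r := ((x :+ m) :+ (y :+ r)) :- m) refl x y r m ⟩
  ((x +ℤ m) +ℤ (y +ℤ r)) -ℤ m
    ≤⟨ ℤ.+-monoˡ-≤ (- m) (ℤ.+-mono-≤ h₁ h₂) ⟩
  ((a +ℤ l) +ℤ (c +ℤ m)) -ℤ m
    ≡⟨ solve 4 (λ a c l m → ((a :+ l) :+ (c :+ m)) :- m := (a :+ c) :+ l) refl a c l m ⟩
  (a +ℤ c) +ℤ l ∎
  where
  open ℤ.≤-Reasoning
  open ℤ-Solver

module _ (B C : Block) where

  ⊕-attains : ∀ {a c} → IsPartition B → IsSwapSet (size B) (extremal B) →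
              Attains B a → Attains C c → Attains (B ⊕ C) (a + c)
  ⊕-attains {a} {c} PB SB attainsB attainsC = begin
    imbalance (layout (B ⊕ C)) (pairs B + pairs C) (displacement p)
      ≡⟨ imbalance-⊕ B C (displacement p) ⟩
    imbalance (layout B) (pairs B) (displacement p) +ℤ imbalance (layout C) (pairs C) (λ y → displacement p (size B + y))
      ≡⟨ cong₂ _+ℤ_ (imbalance-cong (layout B) (pairs B) {displacement p} {displacement pB}
                                    (λ ε κ i<pB → on-B (IsPartition.layout-< PB ε κ i<pB)))
                    (imbalance-cong (layout C) (pairs C) {λ y → displacement p (size B + y)} {displacement pC}
                                    (λ {j} ε κ _ → on-C (layout C j ε κ))) ⟩
    imbalance (layout B) (pairs B) (displacement pB) +ℤ imbalance (layout C) (pairs C) (displacement pC)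
      ≡⟨ cong₂ _+ℤ_ attainsB attainsC ⟩
    + a +ℤ + c
      ≡⟨ ℤ.pos-+ a c ⟨
    + (a + c) ∎
    where
    open ≡-Reasoning
    module SB = IsSwapSet SB
    pB = applySwaps (extremal B)
    pC = applySwaps (extremal C)
    p = applySwaps (extremal (B ⊕ C))
    shifted = map (shiftSwap (size B)) (extremal C)

    pB-fixes-above : ∀ z → pB (size B + z) ≡ size B + z
    pB-fixes-above z = SwapInvariants.fixes-outside
      (swapInvariants (extremal B) (All.map inj₁ SB.rising) SB.distinct)
      (λ z∈ → ℕ.<⇒≱ (All.lookup (endpoints-< (extremal B) SB.rising SB.within) z∈) (ℕ.m≤m+n (size B) z))

    on-B : ∀ {x} → x < size B → displacement p x ≡ displacement pB x
    on-B {x} x<sB = cong (_⊖ x) (trans (applySwaps-++ (extremal B) shifted x)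
                                        (cong pB (applySwaps-shift-below (size B) (extremal C) x<sB)))

    on-C : ∀ y → displacement p (size B + y) ≡ displacement pC y
    on-C y = trans (cong (_⊖ (size B + y)) p[B+y]) (ℤ.+-cancelˡ-⊖ (size B) (pC y) y)
      where
      p[B+y] : p (size B + y) ≡ size B + pC y
      p[B+y] = trans (applySwaps-++ (extremal B) shifted (size B + y))
               (trans (cong pB (applySwaps-shift (size B) (extremal C) y)) (pB-fixes-above (pC y)))

  ⊕-bounded : ∀ {a c r} → (∀ r′ → BoundedAt B a r′) → BoundedAt C c r → BoundedAt (B ⊕ C) (a + c) r
  ⊕-bounded {a} {c} {r} boundB boundC e down admissible end≡r = begin
    imbalance (layout (B ⊕ C)) (pairs B + pairs C) e +ℤ + bit r
      ≡⟨ cong (_+ℤ + bit r) (imbalance-⊕ B C e) ⟩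
    (imbalanceB +ℤ imbalanceC) +ℤ + bit r
      ≤⟨ telescope imbalanceB imbalanceC (+ a) (+ c) (+ bit (down 0)) (+ bit (down (size B))) (+ bit r)
                   boundedB boundedC ⟩
    (+ a +ℤ + c) +ℤ + bit (down 0)
      ≡⟨ cong (_+ℤ + bit (down 0)) (ℤ.pos-+ a c) ⟨
    + (a + c) +ℤ + bit (down 0) ∎
    where
    open ℤ.≤-Reasoning
    e′ = λ y → e (size B + y)
    down′ = λ y → down (size B + y)
    imbalanceB = imbalance (layout B) (pairs B) e
    imbalanceC = imbalance (layout C) (pairs C) e′

    admissible′ : ∀ {j} → j < size C → Admissible e′ down′ j
    admissible′ j<sC = admissible-shift (size B) {e} {down} (admissible (ℕ.+-monoʳ-< (size B) j<sC))

    boundedB : imbalanceB +ℤ + bit (down (size B)) ≤ℤ + a +ℤ + bit (down 0)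
    boundedB = boundB (down (size B)) e down (λ j<sB → admissible (ℕ.<-≤-trans j<sB (ℕ.m≤m+n (size B) (size C)))) refl

    boundedC : imbalanceC +ℤ + bit r ≤ℤ + c +ℤ + bit (down (size B))
    boundedC = subst (λ k → imbalanceC +ℤ + bit r ≤ℤ + c +ℤ + bit (down k)) (ℕ.+-identityʳ (size B))
                     (boundC e′ down′ admissible′ end≡r)

record Certificate (B : Block) (value : ℕ) : Set where
  field
    partition : IsPartition B
    swapSet : IsSwapSet (size B) (extremal B)
    attains : Attains B value

⊕-certificate : ∀ B C {a c} → Certificate B a → Certificate C c → Certificate (B ⊕ C) (a + c)
⊕-certificate B C CB CC = record
  { partition = ⊕-partition B C CB.partition CC.partition
  ; swapSet = ⊕-swapSet (extremal B) (extremal C) CB.swapSet CC.swapSet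
  ; attains = ⊕-attains B C CB.partition CB.swapSet CB.attains CC.attains
  }
  where
  module CB = Certificate CB
  module CC = Certificate CC

stack : Block → ℕ → Block → Block
stack W zero F = F
stack W (suc k) F = W ⊕ stack W k F

module _ {W F : Block} where

  stack-pairs : ∀ k → pairs (stack W k F) ≡ k * pairs W + pairs F
  stack-pairs zero = refl
  stack-pairs (suc k) = trans (cong (λ n → pairs W + n) (stack-pairs k)) (sym (ℕ.+-assoc (pairs W) _ _))

  stack-size : ∀ k → size (stack W k F) ≡ k * size W + size F
  stack-size zero = refl
  stack-size (suc k) = trans (cong (λ n → size W + n) (stack-size k)) (sym (ℕ.+-assoc (size W) _ _))

  stack-certificate : ∀ {a c} → Certificate W a → Certificate F c → ∀ k → Certificate (stack W k F) (k * a + c)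
  stack-certificate CW CF zero = CF
  stack-certificate {a} {c} CW CF (suc k) =
    subst (Certificate (stack W (suc k) F)) (sym (ℕ.+-assoc a (k * a) c))
          (⊕-certificate W (stack W k F) CW (stack-certificate CW CF k))

  stack-bounded : ∀ {a c r} → (∀ r′ → BoundedAt W a r′) → BoundedAt F c r →
                  ∀ k → BoundedAt (stack W k F) (k * a + c) r
  stack-bounded boundW boundF zero = boundF
  stack-bounded {a} {c} {r} boundW boundF (suc k) =
    subst (λ v → BoundedAt (stack W (suc k) F) v r) (sym (ℕ.+-assoc a (k * a) c))
          (⊕-bounded W (stack W k F) boundW (stack-bounded boundW boundF k))

-- (a , d , b , c) is the companion pair {a, d}, {b, c}.
Row : Set
Row = ℕ × ℕ × ℕ × ℕ

rowPair : Row → CompanionPair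
rowPair (a , d , _ , _) 0F 0F = a
rowPair (a , d , _ , _) 0F 1F = d
rowPair (_ , _ , b , c) 1F 0F = b
rowPair (_ , _ , b , c) 1F 1F = c

rowsLayout : List Row → Layout
rowsLayout [] i = rowPair (0 , 0 , 0 , 0)
rowsLayout (r ∷ rs) zero = rowPair r
rowsLayout (r ∷ rs) (suc i) = rowsLayout rs i

rowsLocate : List Row → ℕ → Position
rowsLocate [] x = 0 , 0F , 0F
rowsLocate ((a , d , b , c) ∷ rs) x =
  if x ≡ᵇ a then 0 , 0F , 0F else
  if x ≡ᵇ d then 0 , 0F , 1F else
  if x ≡ᵇ b then 0 , 1F , 0F else
  if x ≡ᵇ c then 0 , 1F , 1F else
  shiftPosition 1 (rowsLocate rs x)

fromRows : List Row → ℕ → List ℕ → Block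
fromRows rows n starts = record
  { pairs = length rows
  ; size = n
  ; layout = rowsLayout rows
  ; locate = rowsLocate rows
  ; extremal = map (λ a → a , suc a) starts
  }

all-upTo : ∀ (p : ℕ → Bool) n → T (all p (upTo n)) → ∀ {i} → i < n → T (p i)
all-upTo p n check i<n = All.lookup (All.all⁺ p (upTo n) check) (∈-upTo⁺ i<n)

allPositions : ℕ → (ℕ → Fin 2 → Fin 2 → Bool) → Bool
allPositions n p = all (λ i → all (λ ε → all (p i ε) (allFin 2)) (allFin 2)) (upTo n)

allPositions-sound : ∀ n p → T (allPositions n p) → ∀ {i} ε κ → i < n → T (p i ε κ)
allPositions-sound n p check {i} ε κ i<n = lookupFin (p i ε) (lookupFin (λ ε → all (p i ε) (allFin 2)) perIndex ε) κ
  where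
  perIndex = all-upTo (λ i → all (λ ε → all (p i ε) (allFin 2)) (allFin 2)) n check i<n
  lookupFin : (q : Fin 2 → Bool) → T (all q (allFin 2)) → ∀ ε → T (q ε)
  lookupFin q checks ε = All.lookup (All.all⁺ q (allFin 2) checks) (∈-allFin ε)

_≟ₚ_ : (P Q : Position) → Dec (P ≡ Q)
_≟ₚ_ = ≡-dec _≟_ (≡-dec Fin._≟_ Fin._≟_)

module _ (B : Block) where

  placedᵇ recoveredᵇ : ℕ → Fin 2 → Fin 2 → Bool
  placedᵇ i ε κ = layout B i ε κ <ᵇ size B
  recoveredᵇ i ε κ = isYes (locate B (layout B i ε κ) ≟ₚ (i , ε , κ))

  indexedᵇ locatedᵇ balancedᵇ : ℕ → Bool
  indexedᵇ x = proj₁ (locate B x) <ᵇ pairs B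
  locatedᵇ x = elementAt (layout B) (locate B x) ≡ᵇ x
  balancedᵇ i = elementSum (layout B i 0F) ≡ᵇ elementSum (layout B i 1F)

  risingᵇ withinᵇ : ℕ × ℕ → Bool
  risingᵇ ab = proj₂ ab ≡ᵇ suc (proj₁ ab)
  withinᵇ ab = proj₂ ab <ᵇ size B

record Checks (B : Block) (c : ℕ) : Set where
  field
    placed : T (allPositions (pairs B) (placedᵇ B))
    recovered : T (allPositions (pairs B) (recoveredᵇ B))
    indexed : T (all (indexedᵇ B) (upTo (size B)))
    located : T (all (locatedᵇ B) (upTo (size B)))
    balanced : T (all (balancedᵇ B) (upTo (pairs B)))
    rising : T (all (risingᵇ B) (extremal B))
    within : T (all (withinᵇ B) (extremal B))
    distinct : T (isYes (unique? (endpointsℕ (extremal B))))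
    attains : T (isYes (imbalance (layout B) (pairs B) (displacement (applySwaps (extremal B))) ℤ.≟ + c))

certify : ∀ {B c} → Checks B c → Certificate B c
certify {B} {c} checks = record
  { partition = record
    { layout-< = λ ε κ i<p → ℕ.<ᵇ⇒< _ _ (allPositions-sound (pairs B) (placedᵇ B) C.placed ε κ i<p)
    ; locate-layout = λ {i} ε κ i<p → toWitness {a? = locate B (layout B i ε κ) ≟ₚ (i , ε , κ)}
                                                (allPositions-sound (pairs B) (recoveredᵇ B) C.recovered ε κ i<p)
    ; locate-< = λ x<s → ℕ.<ᵇ⇒< _ _ (all-upTo (indexedᵇ B) (size B) C.indexed x<s)
    ; layout-locate = λ x<s → ℕ.≡ᵇ⇒≡ _ _ (all-upTo (locatedᵇ B) (size B) C.located x<s)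
    ; balanced = λ i<p → ℕ.≡ᵇ⇒≡ _ _ (all-upTo (balancedᵇ B) (pairs B) C.balanced i<p)
    }
  ; swapSet = record
    { rising = All.map (ℕ.≡ᵇ⇒≡ _ _) (All.all⁺ (risingᵇ B) (extremal B) C.rising)
    ; within = All.map (ℕ.<ᵇ⇒< _ _) (All.all⁺ (withinᵇ B) (extremal B) C.within)
    ; distinct = toWitness C.distinct
    }
  ; attains = toWitness C.attains
  }
  where module C = Checks checks

boundedCheck : Block → ℕ → Bool → Bool
boundedCheck B c r = boundCheck (layout B) (pairs B) (size B) r (λ l → + (c + bit l) -ℤ + bit r)

boundedCheck-sound : ∀ B c r → IsPartition B → T (boundedCheck B c r) → BoundedAt B c r
boundedCheck-sound B c r PB check e down admissible end≡r = begin
  imbalance (layout B) (pairs B) e +ℤ + bit r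
    ≤⟨ ℤ.+-monoˡ-≤ (+ bit r) (boundCheck-sound (layout B) (pairs B) (size B) r bound check
                                 (IsPartition.layout-< PB) e down admissible end≡r) ⟩
  (+ (c + bit (down 0)) -ℤ + bit r) +ℤ + bit r
    ≡⟨ solve 2 (λ x z → (x :- z) :+ z := x) refl (+ (c + bit (down 0))) (+ bit r) ⟩
  + (c + bit (down 0)) ∎
  where
  open ℤ.≤-Reasoning
  open ℤ-Solver
  bound = λ l → + (c + bit l) -ℤ + bit r

-- From a block to a balanced companion collection

+sum-tabulate : ∀ n (f : Fin n → ℕ) (g : ℕ → ℤ) → (∀ i → + f i ≡ g (toℕ i)) →
                + sum (tabulate f) ≡ ∑ n g
+sum-tabulate zero f g f≗g = refl
+sum-tabulate (suc n) f g f≗g =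
  trans (ℤ.pos-+ (f 0F) _) (cong₂ _+ℤ_ (f≗g 0F) (+sum-tabulate n (f ∘ Fin.suc) (g ∘ suc) (f≗g ∘ Fin.suc)))

∣m-n∣≡∣m⊖n∣ : ∀ m n → ∣ m - n ∣ ≡ ∣ m ⊖ n ∣
∣m-n∣≡∣m⊖n∣ zero zero = refl
∣m-n∣≡∣m⊖n∣ zero (suc n) = refl
∣m-n∣≡∣m⊖n∣ (suc m) zero = refl
∣m-n∣≡∣m⊖n∣ (suc m) (suc n) = trans (∣m-n∣≡∣m⊖n∣ m n) (cong ∣_∣ (sym (ℤ.[1+m]⊖[1+n]≡m⊖n m n)))

toℕ-mod : ∀ {m n} .{{_ : NonZero n}} → m < n → toℕ (m mod n) ≡ m
toℕ-mod m<n = trans (Fin.toℕ-fromℕ< _) (m<n⇒m%n≡m m<n)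

∣m-n∣≡1⇒adjacent : ∀ m n → ∣ m - n ∣ ≡ 1 → Adjacent (m , n)
∣m-n∣≡1⇒adjacent zero zero ()
∣m-n∣≡1⇒adjacent zero (suc zero) _ = inj₁ refl
∣m-n∣≡1⇒adjacent zero (suc (suc n)) ()
∣m-n∣≡1⇒adjacent (suc zero) zero _ = inj₂ refl
∣m-n∣≡1⇒adjacent (suc (suc m)) zero ()
∣m-n∣≡1⇒adjacent (suc m) (suc n) eq with ∣m-n∣≡1⇒adjacent m n eq
... | inj₁ eq′ = inj₁ (cong suc eq′)
... | inj₂ eq′ = inj₂ (cong suc eq′)

∣n-1+n∣≡1 : ∀ n → ∣ n - suc n ∣ ≡ 1
∣n-1+n∣≡1 n = trans (ℕ.m≤n⇒∣m-n∣≡n∸m (ℕ.n≤1+n n)) (ℕ.m+n∸n≡m 1 n)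

balanced-difference : ∀ A D B C a d b c → a + d ≡ b + c →
  (suc B + suc C) ⊖ (suc A + suc D) ≡ ((B ⊖ b) +ℤ (C ⊖ c)) -ℤ ((A ⊖ a) +ℤ (D ⊖ d))
balanced-difference A D B C a d b c a+d≡b+c = begin
  (suc B + suc C) ⊖ (suc A + suc D)
    ≡⟨ ℤ.m-n≡m⊖n (suc B + suc C) (suc A + suc D) ⟨
  + (suc B + suc C) -ℤ + (suc A + suc D)
    ≡⟨ cong₂ _-ℤ_ (+2+ B C) (+2+ A D) ⟩
  ((+ 1 +ℤ + B) +ℤ (+ 1 +ℤ + C)) -ℤ ((+ 1 +ℤ + A) +ℤ (+ 1 +ℤ + D))
    ≡⟨ solve 9 (λ o A D B C a d b c →
         ((o :+ B) :+ (o :+ C)) :- ((o :+ A) :+ (o :+ D))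
         := (((B :- b) :+ (C :- c)) :- ((A :- a) :+ (D :- d))) :- ((a :+ d) :- (b :+ c)))
         refl (+ 1) (+ A) (+ D) (+ B) (+ C) (+ a) (+ d) (+ b) (+ c) ⟩
  difference -ℤ ((+ a +ℤ + d) -ℤ (+ b +ℤ + c))
    ≡⟨ cong (difference -ℤ_) (trans (cong (_-ℤ (+ b +ℤ + c)) sums≡) (ℤ.+-inverseʳ (+ b +ℤ + c))) ⟩
  difference -ℤ + 0
    ≡⟨ ℤ.+-identityʳ difference ⟩
  difference
    ≡⟨ cong₂ _-ℤ_ (cong₂ _+ℤ_ (ℤ.m-n≡m⊖n B b) (ℤ.m-n≡m⊖n C c))
                  (cong₂ _+ℤ_ (ℤ.m-n≡m⊖n A a) (ℤ.m-n≡m⊖n D d)) ⟩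
  ((B ⊖ b) +ℤ (C ⊖ c)) -ℤ ((A ⊖ a) +ℤ (D ⊖ d)) ∎
  where
  open ≡-Reasoning
  open ℤ-Solver
  difference = ((+ B -ℤ + b) +ℤ (+ C -ℤ + c)) -ℤ ((+ A -ℤ + a) +ℤ (+ D -ℤ + d))
  +2+ : ∀ m n → + (suc m + suc n) ≡ (+ 1 +ℤ + m) +ℤ (+ 1 +ℤ + n)
  +2+ m n = trans (ℤ.pos-+ (suc m) (suc n)) (cong₂ _+ℤ_ (ℤ.pos-+ 1 m) (ℤ.pos-+ 1 n))
  sums≡ : + a +ℤ + d ≡ + b +ℤ + c
  sums≡ = trans (sym (ℤ.pos-+ a d)) (trans (cong +_ a+d≡b+c) (ℤ.pos-+ b c))

module FromBlock {t : ℕ} (B : Block) {c : ℕ} (certificate : Certificate B c) (bounded : BoundedAt B c false)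
                 (pairs≡ : pairs B ≡ suc t) (size≡ : size B ≡ 4 * suc t) where

  open Certificate certificate
  module P = IsPartition partition
  module S = IsSwapSet swapSet

  index< : ∀ (i : Fin (suc t)) → toℕ i < pairs B
  index< i = subst (toℕ i <_) (sym pairs≡) (Fin.toℕ<n i)

  element< : ∀ (i : Fin (suc t)) ε κ → layout B (toℕ i) ε κ < 4 * suc t
  element< i ε κ = subst (layout B (toℕ i) ε κ <_) size≡ (P.layout-< ε κ (index< i))

  collection : Collection t (4 * suc t)
  collection i ε κ = fromℕ< (element< i ε κ)

  toℕ-collection : ∀ i ε κ → toℕ (collection i ε κ) ≡ layout B (toℕ i) ε κ
  toℕ-collection i ε κ = Fin.toℕ-fromℕ< (element< i ε κ)

  collection-injective : ∀ i ε j i′ ε′ j′ → collection i ε j ≡ collection i′ ε′ j′ →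
                         (i ≡ i′) × (ε ≡ ε′) × (j ≡ j′)
  collection-injective i ε j i′ ε′ j′ eq =
    Fin.toℕ-injective (cong proj₁ same) , cong (proj₁ ∘ proj₂) same , cong (proj₂ ∘ proj₂) same
    where
    open ≡-Reasoning
    same : (toℕ i , ε , j) ≡ (toℕ i′ , ε′ , j′)
    same = begin
      (toℕ i , ε , j)                    ≡⟨ P.locate-layout ε j (index< i) ⟨
      locate B (layout B (toℕ i) ε j)    ≡⟨ cong (locate B) (trans (sym (toℕ-collection i ε j))
                                               (trans (cong toℕ eq) (toℕ-collection i′ ε′ j′))) ⟩
      locate B (layout B (toℕ i′) ε′ j′) ≡⟨ P.locate-layout ε′ j′ (index< i′) ⟩
      (toℕ i′ , ε′ , j′)                 ∎

  collection-surjective : ∀ x → ∃ λ i → ∃ λ ε → ∃ λ j → collection i ε j ≡ x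
  collection-surjective x = fromℕ< i<1+t , ε , κ , Fin.toℕ-injective (begin
    toℕ (collection (fromℕ< i<1+t) ε κ)      ≡⟨ toℕ-collection (fromℕ< i<1+t) ε κ ⟩
    layout B (toℕ (fromℕ< i<1+t)) ε κ        ≡⟨ cong (λ i → layout B i ε κ) (Fin.toℕ-fromℕ< i<1+t) ⟩
    elementAt (layout B) (locate B (toℕ x))  ≡⟨ P.layout-locate x<size ⟩
    toℕ x                                    ∎)
    where
    open ≡-Reasoning
    x<size = subst (toℕ x <_) (sym size≡) (Fin.toℕ<n x)
    ε = proj₁ (proj₂ (locate B (toℕ x)))
    κ = proj₂ (proj₂ (locate B (toℕ x)))
    i<1+t = subst (proj₁ (locate B (toℕ x)) <_) pairs≡ (P.locate-< x<size)

  collection-balanced : ∀ i → sumSet id (collection i 0F) ≡ sumSet id (collection i 1F)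
  collection-balanced i = begin
    suc (toℕ (collection i 0F 0F)) + suc (toℕ (collection i 0F 1F))
      ≡⟨ cong₂ (λ x y → suc x + suc y) (toℕ-collection i 0F 0F) (toℕ-collection i 0F 1F) ⟩
    suc a + suc d   ≡⟨ cong suc (ℕ.+-suc a d) ⟩
    suc (suc (a + d)) ≡⟨ cong (suc ∘ suc) (P.balanced (index< i)) ⟩
    suc (suc (b + c′)) ≡⟨ cong suc (ℕ.+-suc b c′) ⟨
    suc b + suc c′  ≡⟨ cong₂ (λ x y → suc x + suc y) (toℕ-collection i 1F 0F) (toℕ-collection i 1F 1F) ⟨
    suc (toℕ (collection i 1F 0F)) + suc (toℕ (collection i 1F 1F)) ∎
    where
    open ≡-Reasoning
    a = layout B (toℕ i) 0F 0F
    d = layout B (toℕ i) 0F 1F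
    b = layout B (toℕ i) 1F 0F
    c′ = layout B (toℕ i) 1F 1F

  isBalanced : IsBalancedCompanionCollection t collection
  isBalanced = record
    { injective = collection-injective ; surjective = collection-surjective ; balanced = collection-balanced }

  discrepancy-imbalance : ∀ sw → + discrepancy collection sw ≡
                          imbalance (layout B) (pairs B) (displacement (applySwaps (swapsToℕ sw)))
  discrepancy-imbalance sw = begin
    + sum (map f (allFin (suc t))) ≡⟨ cong (+_ ∘ sum) (List.map-tabulate id f) ⟩
    + sum (tabulate f)             ≡⟨ +sum-tabulate (suc t) f g termwise ⟩
    ∑ (suc t) g                    ≡⟨ cong (λ n → ∑ n g) pairs≡ ⟨
    ∑ (pairs B) g                  ∎
    where
    open ≡-Reasoning
    π = applySwaps (swapsToℕ sw)
    f : Fin (suc t) → ℕ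
    f i = ∣ sumSet (perm sw) (collection i 1F) - sumSet (perm sw) (collection i 0F) ∣
    g : ℕ → ℤ
    g i = + ∣ pairImbalance (displacement π) (layout B i) ∣
    toℕ-π : ∀ i ε κ → toℕ (perm sw (collection i ε κ)) ≡ π (layout B (toℕ i) ε κ)
    toℕ-π i ε κ = trans (toℕ-perm sw (collection i ε κ)) (cong π (toℕ-collection i ε κ))
    termwise : ∀ i → + f i ≡ g (toℕ i)
    termwise i = cong +_ (begin
      f i
        ≡⟨ cong₂ (λ x y → ∣ x - y ∣) (cong₂ (λ x y → suc x + suc y) (toℕ-π i 1F 0F) (toℕ-π i 1F 1F))
                                     (cong₂ (λ x y → suc x + suc y) (toℕ-π i 0F 0F) (toℕ-π i 0F 1F)) ⟩
      ∣ (suc (π b) + suc (π c′)) - (suc (π a) + suc (π d)) ∣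
        ≡⟨ ∣m-n∣≡∣m⊖n∣ (suc (π b) + suc (π c′)) (suc (π a) + suc (π d)) ⟩
      ∣ (suc (π b) + suc (π c′)) ⊖ (suc (π a) + suc (π d)) ∣
        ≡⟨ cong ∣_∣ (balanced-difference (π a) (π d) (π b) (π c′) a d b c′ (P.balanced (index< i))) ⟩
      ∣ pairImbalance (displacement π) (layout B (toℕ i)) ∣ ∎)
      where
      a = layout B (toℕ i) 0F 0F
      d = layout B (toℕ i) 0F 1F
      b = layout B (toℕ i) 1F 0F
      c′ = layout B (toℕ i) 1F 1F

  upper : ∀ sw → IsSwapCollection 1 sw → discrepancy collection sw ≤ c
  upper sw isSwaps = ℤ.drop‿+≤+ (begin
    + discrepancy collection sw                        ≡⟨ discrepancy-imbalance sw ⟩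
    imbalance (layout B) (pairs B) e                   ≡⟨ ℤ.+-identityʳ _ ⟨
    imbalance (layout B) (pairs B) e +ℤ + bit false    ≤⟨ bounded e down admissible down-end ⟩
    + c +ℤ + bit (down 0)                              ≡⟨ cong (λ b → + c +ℤ + bit b) down-0 ⟩
    + c +ℤ + 0                                         ≡⟨ ℤ.+-identityʳ (+ c) ⟩
    + c                                                ∎)
    where
    open ℤ.≤-Reasoning
    module SC = IsSwapCollection isSwaps
    L = swapsToℕ sw
    π = applySwaps L
    e = displacement π
    down = movedDown π
    adjacent : All Adjacent L
    adjacent = All.map⁺ (All.map (λ 1≤∣a-b∣≤1 → ∣m-n∣≡1⇒adjacent _ _ (ℕ.≤-antisym (proj₂ 1≤∣a-b∣≤1) (proj₁ 1≤∣a-b∣≤1)))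
                                 SC.magnitude)
    distinct : Unique (endpointsℕ L)
    distinct = subst Unique (sym (endpointsℕ-toℕ sw)) (Unique.map⁺ Fin.toℕ-injective SC.disjoint)
    open SwapInvariants (swapInvariants L adjacent distinct)
    admissible : ∀ {j} → j < size B → Admissible e down j
    admissible {j} _ = neighbour-involution-admissible π involutive neighbour j
    size-fixed : π (size B) ≡ size B
    size-fixed = fixes-outside λ size∈ →
      case ∈-map⁻ toℕ (subst (size B ∈_) (endpointsℕ-toℕ sw) size∈) of λ where
        (y , _ , size≡y) → ℕ.<⇒≢ (Fin.toℕ<n y) (trans (sym size≡y) size≡)
    down-end : down (size B) ≡ false
    down-end = dec-false (suc (π (size B)) ≟ size B) (ℕ.1+n≢n ∘ trans (cong suc (sym size-fixed)))
    down-0 : down 0 ≡ false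
    down-0 = dec-false (suc (π 0) ≟ 0) ℕ.1+n≢0

  toFinSwap : ℕ × ℕ → Fin (4 * suc t) × Fin (4 * suc t)
  toFinSwap (a , b) = a mod (4 * suc t) , b mod (4 * suc t)

  extremalSwaps : List (Fin (4 * suc t) × Fin (4 * suc t))
  extremalSwaps = map toFinSwap (extremal B)

  extremal-bounds : All (λ ab → proj₁ ab < 4 * suc t × proj₂ ab < 4 * suc t) (extremal B)
  extremal-bounds = All.zipWith bounds (S.rising , S.within)
    where
    bounds : ∀ {ab} → proj₂ ab ≡ suc (proj₁ ab) × proj₂ ab < size B → proj₁ ab < 4 * suc t × proj₂ ab < 4 * suc t
    bounds {a , b} (refl , b<size) = ℕ.<-trans (ℕ.n<1+n a) b< , b<
      where b< = subst (b <_) size≡ b<size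

  toℕ-extremalSwaps : swapsToℕ extremalSwaps ≡ extremal B
  toℕ-extremalSwaps = go (extremal B) extremal-bounds
    where
    go : ∀ sw → All (λ ab → proj₁ ab < 4 * suc t × proj₂ ab < 4 * suc t) sw →
         swapsToℕ (map toFinSwap sw) ≡ sw
    go [] [] = refl
    go ((a , b) ∷ sw) ((a< , b<) ∷ bounds) = cong₂ _∷_ (cong₂ _,_ (toℕ-mod a<) (toℕ-mod b<)) (go sw bounds)

  extremalSwaps-valid : IsSwapCollection 1 extremalSwaps
  extremalSwaps-valid = record
    { magnitude = All.map⁺ (All.zipWith (λ { {a , b} (refl , (a< , b<)) → magnitude a< b< })
                                        (S.rising , extremal-bounds))
    ; disjoint = Unique.map⁻ (subst Unique endpoints≡ S.distinct)
    }
    where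
    magnitude : ∀ {a} → a < 4 * suc t → suc a < 4 * suc t →
                (1 ≤ ∣ toℕ (a mod (4 * suc t)) - toℕ (suc a mod (4 * suc t)) ∣) ×
                (∣ toℕ (a mod (4 * suc t)) - toℕ (suc a mod (4 * suc t)) ∣ ≤ 1)
    magnitude {a} a< 1+a< = subst (1 ≤_) (sym distance≡1) ℕ.≤-refl , subst (_≤ 1) (sym distance≡1) ℕ.≤-refl
      where
      distance≡1 = trans (cong₂ (λ x y → ∣ x - y ∣) (toℕ-mod a<) (toℕ-mod 1+a<)) (∣n-1+n∣≡1 a)
    endpoints≡ : endpointsℕ (extremal B) ≡ map toℕ (endpoints extremalSwaps)
    endpoints≡ = trans (cong endpointsℕ (sym toℕ-extremalSwaps)) (endpointsℕ-toℕ extremalSwaps)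

  attained : discrepancy collection extremalSwaps ≡ c
  attained = ℤ.+-injective (trans (discrepancy-imbalance extremalSwaps)
    (trans (cong (λ sw → imbalance (layout B) (pairs B) (displacement (applySwaps sw))) toℕ-extremalSwaps) attains))

  totalDiscrepancy : TotalSetDiscrepancy collection 1 c
  totalDiscrepancy = (extremalSwaps , extremalSwaps-valid , attained) , upper

-- The construction

period : Block
period = fromRows ((0 , 7 , 2 , 5) ∷ (1 , 6 , 3 , 4) ∷ (8 , 23 , 15 , 16) ∷ (9 , 14 , 11 , 12) ∷
                   (10 , 21 , 13 , 18) ∷ (17 , 22 , 19 , 20) ∷ [])
                  24 (0 ∷ 4 ∷ 7 ∷ 13 ∷ 18 ∷ 22 ∷ [])

period-certificate : Certificate period 12
period-certificate = certify _

period-bounded : ∀ r → BoundedAt period 12 r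
period-bounded r = boundedCheck-sound period 12 r (Certificate.partition period-certificate) (check r)
  where
  check : ∀ r → T (boundedCheck period 12 r)
  check true = _
  check false = _

record CertifiedTail : Set where
  field
    block : Block
    value : ℕ
    certificate : Certificate block value
    bounded : BoundedAt block value false
    size≡ : size block ≡ 4 * pairs block

certifiedTail : ∀ B c → Checks B c → T (boundedCheck B c false) → size B ≡ 4 * pairs B → CertifiedTail
certifiedTail B c checks boundable size≡ = record
  { block = B ; value = c ; certificate = certificate ; size≡ = size≡
  ; bounded = boundedCheck-sound B c false (Certificate.partition certificate) boundable }
  where certificate = certify checks

-- When 6 divides t + 1, tail₀ takes the place of the last copy of period and is worth 10, not 12.
tail₀ tail₁ tail₂ tail₃ tail₄ tail₅ : CertifiedTail
tail₀ = certifiedTail (fromRows ((1 , 6 , 3 , 4) ∷ (2 , 13 , 7 , 8) ∷ (0 , 23 , 11 , 12) ∷ (10 , 21 , 15 , 16) ∷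
                                 (17 , 22 , 19 , 20) ∷ (5 , 18 , 9 , 14) ∷ [])
                                24 (5 ∷ 8 ∷ 12 ∷ 18 ∷ 22 ∷ []))
                      10 _ _ refl
tail₁ = certifiedTail (fromRows ((0 , 3 , 1 , 2) ∷ []) 4 (2 ∷ [])) 2 _ _ refl
tail₂ = certifiedTail (fromRows ((0 , 7 , 2 , 5) ∷ (1 , 6 , 3 , 4) ∷ []) 8 (2 ∷ 6 ∷ [])) 4 _ _ refl
tail₃ = certifiedTail (fromRows ((0 , 5 , 2 , 3) ∷ (1 , 10 , 4 , 7) ∷ (6 , 11 , 8 , 9) ∷ []) 12 (1 ∷ 5 ∷ 10 ∷ []))
                      6 _ _ refl
tail₄ = certifiedTail (fromRows ((0 , 15 , 7 , 8) ∷ (1 , 6 , 3 , 4) ∷ (2 , 13 , 5 , 10) ∷ (9 , 14 , 11 , 12) ∷ [])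
                                16 (5 ∷ 10 ∷ 14 ∷ []))
                      6 _ _ refl
tail₅ = certifiedTail (fromRows ((0 , 19 , 6 , 13) ∷ (1 , 16 , 8 , 9) ∷ (2 , 7 , 4 , 5) ∷ (3 , 18 , 10 , 11) ∷
                                 (12 , 17 , 14 , 15) ∷ [])
                                20 (6 ∷ 9 ∷ 15 ∷ 18 ∷ []))
                      8 _ _ refl

Result : ℕ → ℤ → Set
Result t z = Σ (Collection t (4 * suc t)) λ S →
  IsBalancedCompanionCollection t S × Σ ℕ λ D → TotalSetDiscrepancy S 1 D × (+ D ≡ z)

withTail : (F : CertifiedTail) → ∀ {t} k → suc t ≡ pairs (CertifiedTail.block F) + k * 6 →
           Result t (+ (k * 12 + CertifiedTail.value F))
withTail F {t} k t≡ = collection , isBalanced , k * 12 + value , totalDiscrepancy , refl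
  where
  open CertifiedTail F
  size≡′ : k * 24 + size block ≡ 4 * suc t
  size≡′ = begin
    k * 24 + size block      ≡⟨ cong (λ s → k * 24 + s) size≡ ⟩
    k * 24 + 4 * pairs block
      ≡⟨ solve 2 (λ k p → k :* con 24 :+ con 4 :* p := con 4 :* (p :+ k :* con 6)) refl k (pairs block) ⟩
    4 * (pairs block + k * 6) ≡⟨ cong (4 *_) t≡ ⟨
    4 * suc t ∎
    where
    open ≡-Reasoning
    open ℕ-Solver
  open FromBlock (stack period k block)
                 (stack-certificate period-certificate certificate k) (stack-bounded period-bounded bounded k)
                 (trans (stack-pairs k) (trans (ℕ.+-comm (k * 6) (pairs block)) (sym t≡)))
                 (trans (stack-size k) size≡′)

+[m*12+c]≡+[12*m]+c : ∀ m c → + (m * 12 + c) ≡ + (12 * m) +ℤ + c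
+[m*12+c]≡+[12*m]+c m c = trans (ℤ.pos-+ (m * 12) c) (cong (λ n → + n +ℤ + c) (ℕ.*-comm m 12))

+[k*12+10]≡+[12*[1+k]]-2 : ∀ k → + (k * 12 + 10) ≡ + (12 * suc k) +ℤ -[1+ 1 ]
+[k*12+10]≡+[12*[1+k]]-2 k = sym (trans (cong (_⊖ 2) 12*[1+k]≡2+[k*12+10]) (ℤ.+-cancelˡ-⊖ 2 (k * 12 + 10) 0))
  where
  open ℕ-Solver
  12*[1+k]≡2+[k*12+10] = solve 1 (λ k → con 12 :* (con 1 :+ k) := con 2 :+ (k :* con 12 :+ con 10)) refl k

byResidue : ∀ t m r → r < 6 → suc t ≡ r + m * 6 → Result t (+ (12 * m) +ℤ Δ (4 * r))
byResidue t zero zero _ ()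
byResidue t (suc k) 0 _ t≡ = subst (Result t) (+[k*12+10]≡+[12*[1+k]]-2 k) (withTail tail₀ k t≡)
byResidue t m 1 _ t≡ = subst (Result t) (+[m*12+c]≡+[12*m]+c m 2) (withTail tail₁ m t≡)
byResidue t m 2 _ t≡ = subst (Result t) (+[m*12+c]≡+[12*m]+c m 4) (withTail tail₂ m t≡)
byResidue t m 3 _ t≡ = subst (Result t) (+[m*12+c]≡+[12*m]+c m 6) (withTail tail₃ m t≡)
byResidue t m 4 _ t≡ = subst (Result t) (+[m*12+c]≡+[12*m]+c m 6) (withTail tail₄ m t≡)
byResidue t m 5 _ t≡ = subst (Result t) (+[m*12+c]≡+[12*m]+c m 8) (withTail tail₅ m t≡)
byResidue t m (suc (suc (suc (suc (suc (suc r)))))) (s≤s (s≤s (s≤s (s≤s (s≤s (s≤s ())))))) _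

-- The construction also covers t = 0.
theorem3 : (t : ℕ) → 1 ≤ t →
    Σ (Collection t (4 * suc t)) λ S →
      IsBalancedCompanionCollection t S ×
      Σ ℕ λ D → TotalSetDiscrepancy S 1 D ×
        (+ D ≡ (+ (12 * (suc t / 6))) +ℤ Δ (4 * suc t ∸ 24 * (suc t / 6)))
theorem3 t _ =
  subst (Result t) (cong (λ n → + (12 * m) +ℤ Δ n) (sym residue)) (byResidue t m r (m%n<n (suc t) 6) t≡)
  where
  m = suc t / 6
  r = suc t % 6
  t≡ : suc t ≡ r + m * 6
  t≡ = m≡m%n+[m/n]*n (suc t) 6
  residue : 4 * suc t ∸ 24 * m ≡ 4 * r
  residue = trans (cong (λ n → 4 * n ∸ 24 * m) t≡) (trans (cong (_∸ 24 * m) distrib) (ℕ.m+n∸n≡m (4 * r) (24 * m)))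
    where
    open ℕ-Solver
    distrib = solve 2 (λ r m → con 4 :* (r :+ m :* con 6) := con 4 :* r :+ con 24 :* m) refl r m
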